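{- Let $s$ be a positive integer and let $(f_k(q))_{k\geq 0}$ be a strongly $q$-log-convex sequence of real polynomials. Then the sequence $(B_n(q))_{n\geq 0}$ defined by $B_{n}(q)=\sum_{k=0}^{sn}\binom{n}{k}_{s} f_{k}(q)$ is strongly $q$-log-convex.
   Context: For positive integers $n,s$ (and $n=0$), the bi$^s$nomial coefficients $\binom{n}{k}_s$ are defined by $(1+x+\cdots+x^{s})^{n}=\sum_{k=0}^{sn}\binom{n}{k}_{s}x^{k}$, with $\binom{n}{k}_s=0$ unless $0\leq k\leq sn$. For real polynomials $F(q),G(q)$, write $F(q)\geq_q G(q)$ if $F(q)-G(q)$ has only nonnegative coefficients. A sequence of polynomials $(F_n(q))_{n\geq 0}$ is strongly $q$-log-convex if $F_{n}(q)F_{m}(q)\leq_{q} F_{n-1}(q)F_{m+1}(q)$ for all $m\geq n\geq 1$. -}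

module Defs where

open import Level using (Level; suc; _⊔_)
open import Data.Nat as ℕ using (ℕ; zero; _∸_; _≤_; _<_; _≤?_)
import Data.Nat
open import Data.Product using (∃)
open import Relation.Nullary using (yes; no)
open import Algebra.Bundles using (CommutativeRing)
open import Relation.Binary.Structures using (IsTotalOrder)

-- Bi^s-nomial coefficients, defined literally as the coefficients of
-- (1 + x + ... + x^s)^n, with polynomials over ℕ as coefficient sequences.

sumℕ : ℕ → (ℕ → ℕ) → ℕ
sumℕ zero      f = 0
sumℕ (ℕ.suc n) f = sumℕ n f ℕ.+ f n

convℕ : (ℕ → ℕ) → (ℕ → ℕ) → (ℕ → ℕ)
convℕ f g k = sumℕ (ℕ.suc k) (λ i → f i ℕ.* g (k ∸ i))

onesUpTo : ℕ → (ℕ → ℕ)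
onesUpTo s i with i ≤? s
... | yes _ = 1
... | no  _ = 0

oneℕ : ℕ → ℕ
oneℕ zero      = 1
oneℕ (ℕ.suc _) = 0

powℕ : (ℕ → ℕ) → ℕ → (ℕ → ℕ)
powℕ p zero      = oneℕ
powℕ p (ℕ.suc n) = convℕ (powℕ p n) p

binomS : ℕ → ℕ → ℕ → ℕ
binomS s n k = powℕ (onesUpTo s) n k

-- Ordered commutative rings (the real numbers are an instance).

record OrderedCommRing (c ℓ₁ ℓ₂ : Level) : Set (suc (c ⊔ ℓ₁ ⊔ ℓ₂)) where
  field
    commRing : CommutativeRing c ℓ₁
  open CommutativeRing commRing public
  infix 4 _≤R_
  field
    _≤R_         : Carrier → Carrier → Set ℓ₂
    isTotalOrder : IsTotalOrder _≈_ _≤R_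
    +-mono-≤R    : ∀ {x y} z → x ≤R y → x + z ≤R y + z
    *-nonneg     : ∀ {x y} → 0# ≤R x → 0# ≤R y → 0# ≤R x * y

-- Polynomials over R, represented by their coefficient sequences.

module _ {c ℓ₁ ℓ₂ : Level} (R : OrderedCommRing c ℓ₁ ℓ₂) where
  open OrderedCommRing R

  Seq : Set c
  Seq = ℕ → Carrier

  IsPolynomial : Seq → Set ℓ₁
  IsPolynomial f = ∃ λ d → ∀ i → d < i → f i ≈ 0#

  sumR : ℕ → (ℕ → Carrier) → Carrier
  sumR zero      f = 0#
  sumR (ℕ.suc n) f = sumR n f + f n

  fromℕ : ℕ → Carrier
  fromℕ zero      = 0#
  fromℕ (ℕ.suc n) = 1# + fromℕ n

  _⊛_ : Seq → Seq → Seq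
  (F ⊛ G) k = sumR (ℕ.suc k) (λ i → F i * G (k ∸ i))

  _≤q_ : Seq → Seq → Set ℓ₂
  F ≤q G = ∀ k → 0# ≤R G k - F k

  StronglyQLogConvex : (ℕ → Seq) → Set ℓ₂
  StronglyQLogConvex F =
    ∀ (n m : ℕ) → 1 ≤ n → n ≤ m → (F n ⊛ F m) ≤q (F (n ∸ 1) ⊛ F (ℕ.suc m))

  binomTransform : ℕ → (ℕ → Seq) → ℕ → Seq
  binomTransform s f n i =
    sumR (ℕ.suc (s ℕ.* n)) (λ k → fromℕ (binomS s n k) * f k i)

-- Write C_n(k) for the bi^s-nomial coefficients and F(a, b) for a fixed coefficient of
-- f_a f_b.  Since C_{n+1}(b) = Σ_j C_n(j) [j ≤ b ≤ j + s], expanding the product gives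
--   B_p B_{m+1} = Σ_{a,j} C_p(a) C_m(j) Γ(a, j),   Γ(a, j) = Σ_{u ≤ s} F(a, j + u),
-- and, as F is symmetric, B_{p+1} B_m is the same sum with Γ(j, a) in place of Γ(a, j).
-- For p ≤ m and a < j we have C_p(j) C_m(a) ≤ C_p(a) C_m(j), because the array (C_n(k)) is TP₂ like
-- the kernel [i ≤ k ≤ i + s] of its recurrence, and Γ(j, a) ≤ Γ(a, j), because iterated
-- strong q-log-convexity gives f_{a+d} f_{a+u} ≤_q f_a f_{a+d+u}.  Pairing the (a, j) and
-- (j, a) terms, the rearrangement inequality x y' + x' y ≤ x y + x' y' yields
-- B_{p+1} B_m ≤_q B_p B_{m+1}.

module Submission where

open import Defs hiding (sumR; fromℕ; _⊛_)
open import Level using (Level)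
open import Data.Nat as ℕ using (ℕ; zero; suc; _∸_; _≤_; _<_; _≤?_; z≤n; s≤s)
import Data.Nat.Properties as ℕₚ
open import Data.Product using (_,_) renaming (_×_ to _∧_)
open import Data.Sum using (_⊎_; inj₁; inj₂)
open import Data.Maybe using (nothing)
open import Function using (_∘_)
open import Relation.Nullary using (yes; no; contradiction)
open import Relation.Binary.Bundles using (Poset)
open import Relation.Binary.Structures using (IsTotalOrder)
open import Relation.Binary.PropositionalEquality as ≡ using (_≡_)
import Tactic.RingSolver.Core.AlmostCommutativeRing as ACR
import Tactic.RingSolver.NonReflective as RingSolver

onesUpTo-≤ : ∀ {s u} → u ≤ s → onesUpTo s u ≡ 1
onesUpTo-≤ {s} {u} u≤s with u ≤? s
... | yes _   = ≡.refl
... | no u≰s = contradiction u≤s u≰s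

onesUpTo-> : ∀ {s u} → s < u → onesUpTo s u ≡ 0
onesUpTo-> {s} {u} s<u with u ≤? s
... | yes u≤s = contradiction u≤s (ℕₚ.<⇒≱ s<u)
... | no _    = ≡.refl

-- band s k i is the coefficient of x^k in x^i (1 + x + ... + x^s).
band : ℕ → ℕ → ℕ → ℕ
band s k i with i ≤? k
... | yes _ = onesUpTo s (k ∸ i)
... | no  _ = 0

band-≤ : ∀ {s k i} → i ≤ k → band s k i ≡ onesUpTo s (k ∸ i)
band-≤ {s} {k} {i} i≤k with i ≤? k
... | yes _   = ≡.refl
... | no i≰k = contradiction i≤k i≰k

band-> : ∀ {s k i} → k < i → band s k i ≡ 0
band-> {s} {k} {i} k<i with i ≤? k
... | yes i≤k = contradiction i≤k (ℕₚ.<⇒≱ k<i)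
... | no _    = ≡.refl

band-shift : ∀ s j u → band s (j ℕ.+ u) j ≡ onesUpTo s u
band-shift s j u = ≡.trans (band-≤ (ℕₚ.m≤m+n j u)) (≡.cong (onesUpTo s) (ℕₚ.m+n∸m≡n j u))

band-beyond : ∀ {s k i} → i ℕ.+ s < k → band s k i ≡ 0
band-beyond {s} {k} {i} i+s<k =
  ≡.trans (band-≤ i≤k) (onesUpTo-> (ℕₚ.m+n≤o⇒m≤o∸n (suc s) s+i<k))
  where
  s+i<k : s ℕ.+ i < k
  s+i<k = ≡.subst (_< k) (ℕₚ.+-comm i s) i+s<k
  i≤k : i ≤ k
  i≤k = ℕₚ.≤-trans (ℕₚ.m≤m+n i s) (ℕₚ.<⇒≤ i+s<k)

band-one : ∀ {s k i} → i ≤ k → k ∸ i ≤ s → band s k i ≡ 1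
band-one i≤k k∸i≤s = ≡.trans (band-≤ i≤k) (onesUpTo-≤ k∸i≤s)

band≡0⊎inBand : ∀ s k i → band s k i ≡ 0 ⊎ (i ≤ k ∧ k ∸ i ≤ s)
band≡0⊎inBand s k i with i ≤? k | k ∸ i ≤? s
... | no _     | _          = inj₁ ≡.refl
... | yes i≤k | yes k∸i≤s = inj₂ (i≤k , k∸i≤s)
... | yes i≤k | no k∸i≰s  = inj₁ (onesUpTo-> (ℕₚ.≰⇒> k∸i≰s))

band-TP₂ : ∀ s {a b i j} → a ≤ b → i ≤ j →
           band s a j ℕ.* band s b i ≤ band s a i ℕ.* band s b j
band-TP₂ s {a} {b} {i} {j} a≤b i≤j with band≡0⊎inBand s a j | band≡0⊎inBand s b i
... | inj₁ eq | _ rewrite eq = z≤n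
... | inj₂ _  | inj₁ eq rewrite eq | ℕₚ.*-zeroʳ (band s a j) = z≤n
... | inj₂ (j≤a , a∸j≤s) | inj₂ (i≤b , b∸i≤s)
  rewrite band-one j≤a a∸j≤s | band-one i≤b b∸i≤s
        | band-one (ℕₚ.≤-trans i≤j j≤a) (ℕₚ.≤-trans (ℕₚ.∸-monoˡ-≤ i a≤b) b∸i≤s)
        | band-one (ℕₚ.≤-trans j≤a a≤b) (ℕₚ.≤-trans (ℕₚ.∸-monoʳ-≤ b i≤j) b∸i≤s) = ℕₚ.≤-refl

sumℕ-zero : ∀ n {f} → (∀ i → i < n → f i ≡ 0) → sumℕ n f ≡ 0
sumℕ-zero zero    _   = ≡.refl
sumℕ-zero (suc n) f≡0 =
  ≡.cong₂ ℕ._+_ (sumℕ-zero n (λ i i<n → f≡0 i (ℕₚ.m<n⇒m<1+n i<n))) (f≡0 n ℕₚ.≤-refl)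

s*n<k⇒binomS≡0 : ∀ s n {k} → s ℕ.* n < k → binomS s n k ≡ 0
s*n<k⇒binomS≡0 s zero    {zero}  s*0<0 = contradiction s*0<0 ℕₚ.n≮0
s*n<k⇒binomS≡0 s zero    {suc k} _     = ≡.refl
s*n<k⇒binomS≡0 s (suc n) {k}     lt    = sumℕ-zero (suc k) term
  where
  s<k∸i : ∀ {i} → i ≤ s ℕ.* n → s < k ∸ i
  s<k∸i i≤sn = ℕₚ.m+n≤o⇒m≤o∸n (suc s)
    (ℕₚ.≤-<-trans (ℕₚ.+-monoʳ-≤ s i≤sn) (≡.subst (_< k) (ℕₚ.*-suc s n) lt))
  term : ∀ i → i < suc k → binomS s n i ℕ.* onesUpTo s (k ∸ i) ≡ 0
  term i _ with i ≤? s ℕ.* n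
  ... | no i≰sn  rewrite s*n<k⇒binomS≡0 s n (ℕₚ.≰⇒> i≰sn) = ≡.refl
  ... | yes i≤sn rewrite onesUpTo-> (s<k∸i i≤sn) = ℕₚ.*-zeroʳ (binomS s n i)

module _ {c ℓ₁ ℓ₂ : Level} (R : OrderedCommRing c ℓ₁ ℓ₂) where
  open OrderedCommRing R
  open import Algebra.Properties.Group +-group using (//-rightDividesˡ; ⁻¹-involutive)
  open import Algebra.Properties.Ring ring using (-1*x≈-x; [y-z]x≈yx-zx)
  open import Algebra.Properties.Semiring.Mult semiring using (_×_; ×-homo-+; ×1-homo-*)
  open import Algebra.Properties.CommutativeSemigroup +-commutativeSemigroup
    using () renaming (interchange to +-interchange)
  open import Algebra.Properties.CommutativeSemigroup *-commutativeSemigroup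
    using (xy∙z≈y∙xz) renaming (interchange to *-interchange)

  private
    module ≤R = IsTotalOrder isTotalOrder

    ringᴬ : ACR.AlmostCommutativeRing c ℓ₁
    ringᴬ = ACR.fromCommutativeRing commRing (λ _ → nothing)

    poset : Poset c ℓ₁ ℓ₂
    poset = record { isPartialOrder = ≤R.isPartialOrder }

  open RingSolver ringᴬ using (solve; _⊜_; _⊕_; _⊗_)
  open import Relation.Binary.Reasoning.PartialOrder poset

  Σ : ℕ → (ℕ → Carrier) → Carrier
  Σ = Defs.sumR R

  fromℕ : ℕ → Carrier
  fromℕ = Defs.fromℕ R

  infixl 7 _⊛_
  _⊛_ : Seq R → Seq R → Seq R
  _⊛_ = Defs._⊛_ R

  +-mono-≤ : ∀ {x y u v} → x ≤R y → u ≤R v → x + u ≤R y + v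
  +-mono-≤ {x} {y} {u} {v} x≤y u≤v = begin
    x + u  ≤⟨ +-mono-≤R u x≤y ⟩
    y + u  ≈⟨ +-comm y u ⟩
    u + y  ≤⟨ +-mono-≤R y u≤v ⟩
    v + y  ≈⟨ +-comm v y ⟩
    y + v  ∎

  ≤⇒0≤- : ∀ {x y} → x ≤R y → 0# ≤R y - x
  ≤⇒0≤- {x} {y} x≤y = begin
    0#     ≈⟨ -‿inverseʳ x ⟨
    x - x  ≤⟨ +-mono-≤R (- x) x≤y ⟩
    y - x  ∎

  0≤-⇒≤ : ∀ {x y} → 0# ≤R y - x → x ≤R y
  0≤-⇒≤ {x} {y} 0≤y-x = begin
    x            ≈⟨ +-identityˡ x ⟨
    0# + x       ≤⟨ +-mono-≤R x 0≤y-x ⟩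
    (y - x) + x  ≈⟨ //-rightDividesˡ x y ⟩
    y            ∎

  *-monoˡ-≤-nonneg : ∀ {x y} z → 0# ≤R z → x ≤R y → x * z ≤R y * z
  *-monoˡ-≤-nonneg {x} {y} z 0≤z x≤y = 0≤-⇒≤ (begin
    0#             ≤⟨ *-nonneg (≤⇒0≤- x≤y) 0≤z ⟩
    (y - x) * z    ≈⟨ [y-z]x≈yx-zx z y x ⟩
    y * z - x * z  ∎)

  rearrangement : ∀ {x x′ y y′} → x′ ≤R x → y′ ≤R y → x * y′ + x′ * y ≤R x * y + x′ * y′
  rearrangement {x} {x′} {y} {y′} x′≤x y′≤y = begin
    x * y′ + x′ * y              ≈⟨ +-congˡ (*-congˡ (//-rightDividesˡ y′ y)) ⟨
    x * y′ + x′ * (d + y′)       ≈⟨ expand x x′ y′ d ⟩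
    x′ * d + (x * y′ + x′ * y′)  ≤⟨ +-mono-≤R _ (*-monoˡ-≤-nonneg d (≤⇒0≤- y′≤y) x′≤x) ⟩
    x * d + (x * y′ + x′ * y′)   ≈⟨ collect x x′ y′ d ⟩
    x * (d + y′) + x′ * y′       ≈⟨ +-congʳ (*-congˡ (//-rightDividesˡ y′ y)) ⟩
    x * y + x′ * y′              ∎
    where
    d = y - y′
    expand : ∀ x x′ y′ d → x * y′ + x′ * (d + y′) ≈ x′ * d + (x * y′ + x′ * y′)
    expand = solve 4 (λ x x′ y′ d →
      ((x ⊗ y′) ⊕ (x′ ⊗ (d ⊕ y′))) ⊜ ((x′ ⊗ d) ⊕ ((x ⊗ y′) ⊕ (x′ ⊗ y′)))) refl
    collect : ∀ x x′ y′ d → x * d + (x * y′ + x′ * y′) ≈ x * (d + y′) + x′ * y′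
    collect = solve 4 (λ x x′ y′ d →
      ((x ⊗ d) ⊕ ((x ⊗ y′) ⊕ (x′ ⊗ y′))) ⊜ ((x ⊗ (d ⊕ y′)) ⊕ (x′ ⊗ y′))) refl

  0≤1 : 0# ≤R 1#
  0≤1 with ≤R.total 0# 1#
  ... | inj₁ 0≤1 = 0≤1
  ... | inj₂ 1≤0 = begin
    0#           ≤⟨ *-nonneg 0≤-1 0≤-1 ⟩
    - 1# * - 1#  ≈⟨ -1*x≈-x (- 1#) ⟩
    - - 1#       ≈⟨ ⁻¹-involutive 1# ⟩
    1#           ∎
    where
    0≤-1 : 0# ≤R - 1#
    0≤-1 = begin
      0#       ≈⟨ -‿inverseʳ 1# ⟨
      1# - 1#  ≤⟨ +-mono-≤R (- 1#) 1≤0 ⟩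
      0# - 1#  ≈⟨ +-identityˡ (- 1#) ⟩
      - 1#     ∎

  fromℕ≡×1# : ∀ n → fromℕ n ≡ n × 1#
  fromℕ≡×1# zero    = ≡.refl
  fromℕ≡×1# (suc n) = ≡.cong (1# +_) (fromℕ≡×1# n)

  fromℕ-+ : ∀ m n → fromℕ (m ℕ.+ n) ≈ fromℕ m + fromℕ n
  fromℕ-+ m n = begin-equality
    fromℕ (m ℕ.+ n)    ≡⟨ fromℕ≡×1# (m ℕ.+ n) ⟩
    (m ℕ.+ n) × 1#     ≈⟨ ×-homo-+ 1# m n ⟩
    m × 1# + n × 1#    ≡⟨ ≡.cong₂ _+_ (fromℕ≡×1# m) (fromℕ≡×1# n) ⟨
    fromℕ m + fromℕ n  ∎

  fromℕ-* : ∀ m n → fromℕ (m ℕ.* n) ≈ fromℕ m * fromℕ n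
  fromℕ-* m n = begin-equality
    fromℕ (m ℕ.* n)      ≡⟨ fromℕ≡×1# (m ℕ.* n) ⟩
    (m ℕ.* n) × 1#       ≈⟨ ×1-homo-* m n ⟩
    (m × 1#) * (n × 1#)  ≡⟨ ≡.cong₂ _*_ (fromℕ≡×1# m) (fromℕ≡×1# n) ⟨
    fromℕ m * fromℕ n    ∎

  fromℕ-sumℕ : ∀ n g → fromℕ (sumℕ n g) ≈ Σ n (fromℕ ∘ g)
  fromℕ-sumℕ zero    _ = refl
  fromℕ-sumℕ (suc n) g = trans (fromℕ-+ (sumℕ n g) (g n)) (+-congʳ (fromℕ-sumℕ n g))

  fromℕ-zeroˡ : ∀ {n} x → n ≡ 0 → fromℕ n * x ≈ 0#
  fromℕ-zeroˡ x ≡.refl = zeroˡ x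

  fromℕ-identityˡ : ∀ {n} x → n ≡ 1 → fromℕ n * x ≈ x
  fromℕ-identityˡ x ≡.refl = trans (*-congʳ (+-identityʳ 1#)) (*-identityˡ x)

  fromℕ-nonneg : ∀ n → 0# ≤R fromℕ n
  fromℕ-nonneg zero    = ≤R.refl
  fromℕ-nonneg (suc n) = begin
    0#              ≈⟨ +-identityˡ 0# ⟨
    0# + 0#         ≤⟨ +-mono-≤ 0≤1 (fromℕ-nonneg n) ⟩
    1# + fromℕ n    ∎

  fromℕ-mono : ∀ {m n} → m ≤ n → fromℕ m ≤R fromℕ n
  fromℕ-mono {m} {n} m≤n = begin
    fromℕ m                  ≈⟨ +-identityˡ (fromℕ m) ⟨
    0# + fromℕ m             ≤⟨ +-mono-≤R (fromℕ m) (fromℕ-nonneg (n ∸ m)) ⟩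
    fromℕ (n ∸ m) + fromℕ m  ≈⟨ fromℕ-+ (n ∸ m) m ⟨
    fromℕ (n ∸ m ℕ.+ m)      ≡⟨ ≡.cong fromℕ (ℕₚ.m∸n+n≡m m≤n) ⟩
    fromℕ n                  ∎

  Σ-cong : ∀ n {f g} → (∀ i → i < n → f i ≈ g i) → Σ n f ≈ Σ n g
  Σ-cong zero    _   = refl
  Σ-cong (suc n) f≈g = +-cong (Σ-cong n (λ i i<n → f≈g i (ℕₚ.m<n⇒m<1+n i<n))) (f≈g n ℕₚ.≤-refl)

  Σ-zero : ∀ n {f} → (∀ i → i < n → f i ≈ 0#) → Σ n f ≈ 0#
  Σ-zero n f≈0 = trans (Σ-cong n f≈0) (Σ-zero′ n)
    where
    Σ-zero′ : ∀ n → Σ n (λ _ → 0#) ≈ 0#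
    Σ-zero′ zero    = refl
    Σ-zero′ (suc n) = trans (+-identityʳ _) (Σ-zero′ n)

  Σ-mono-≤ : ∀ n {f g} → (∀ i → i < n → f i ≤R g i) → Σ n f ≤R Σ n g
  Σ-mono-≤ zero    _   = ≤R.refl
  Σ-mono-≤ (suc n) f≤g =
    +-mono-≤ (Σ-mono-≤ n (λ i i<n → f≤g i (ℕₚ.m<n⇒m<1+n i<n))) (f≤g n ℕₚ.≤-refl)

  Σ-distrib-+ : ∀ n f g → Σ n (λ i → f i + g i) ≈ Σ n f + Σ n g
  Σ-distrib-+ zero    _ _ = sym (+-identityʳ 0#)
  Σ-distrib-+ (suc n) f g = trans (+-congʳ (Σ-distrib-+ n f g)) (+-interchange _ _ _ _)

  *-distribˡ-Σ : ∀ n x f → x * Σ n f ≈ Σ n (λ i → x * f i)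
  *-distribˡ-Σ zero    x _ = zeroʳ x
  *-distribˡ-Σ (suc n) x f = trans (distribˡ x _ _) (+-congʳ (*-distribˡ-Σ n x f))

  *-distribʳ-Σ : ∀ n x f → Σ n f * x ≈ Σ n (λ i → f i * x)
  *-distribʳ-Σ zero    x _ = zeroˡ x
  *-distribʳ-Σ (suc n) x f = trans (distribʳ x _ _) (+-congʳ (*-distribʳ-Σ n x f))

  Σ-comm : ∀ n m (g : ℕ → ℕ → Carrier) →
           Σ n (λ i → Σ m (g i)) ≈ Σ m (λ j → Σ n (λ i → g i j))
  Σ-comm zero    m _ = sym (Σ-zero m (λ _ _ → refl))
  Σ-comm (suc n) m g = trans (+-congʳ (Σ-comm n m g)) (sym (Σ-distrib-+ m _ (g n)))

  Σ-*-Σ : ∀ n m f g → Σ n f * Σ m g ≈ Σ n (λ i → Σ m (λ j → f i * g j))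
  Σ-*-Σ n m f g = trans (*-distribʳ-Σ n (Σ m g) f) (Σ-cong n (λ i _ → *-distribˡ-Σ m (f i) g))

  Σ-factor : ∀ n m (x y : ℕ → Carrier) (h : ℕ → ℕ → Carrier) →
             Σ n (λ a → x a * Σ m (λ b → y b * h a b)) ≈ Σ n (λ a → Σ m (λ b → (x a * y b) * h a b))
  Σ-factor n m x y h = Σ-cong n (λ a _ →
    trans (*-distribˡ-Σ m (x a) _) (Σ-cong m (λ b _ → sym (*-assoc (x a) (y b) (h a b)))))

  Σ-split : ∀ m n f → Σ (m ℕ.+ n) f ≈ Σ m f + Σ n (λ j → f (m ℕ.+ j))
  Σ-split m zero    f rewrite ℕₚ.+-identityʳ m = sym (+-identityʳ (Σ m f))
  Σ-split m (suc n) f rewrite ℕₚ.+-suc m n = trans (+-congʳ (Σ-split m n f)) (+-assoc _ _ _)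

  Σ-truncate : ∀ {L N f} → L ≤ N → (∀ i → L ≤ i → f i ≈ 0#) → Σ N f ≈ Σ L f
  Σ-truncate {L} {N} {f} L≤N f≈0 = begin-equality
    Σ N f                                  ≡⟨ ≡.cong (λ n → Σ n f) (ℕₚ.m+[n∸m]≡n L≤N) ⟨
    Σ (L ℕ.+ (N ∸ L)) f                    ≈⟨ Σ-split L (N ∸ L) f ⟩
    Σ L f + Σ (N ∸ L) (λ j → f (L ℕ.+ j))  ≈⟨ +-congˡ (Σ-zero (N ∸ L) (λ j _ → f≈0 _ (ℕₚ.m≤m+n L j))) ⟩
    Σ L f + 0#                             ≈⟨ +-identityʳ (Σ L f) ⟩
    Σ L f                                  ∎

  Σ-head : ∀ n f → Σ (suc n) f ≈ f 0 + Σ n (f ∘ suc)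
  Σ-head n f = trans (Σ-split 1 n f) (+-congʳ (+-identityˡ (f 0)))

  Σ-reverse : ∀ n f → Σ n f ≈ Σ n (λ i → f (n ∸ suc i))
  Σ-reverse zero    _ = refl
  Σ-reverse (suc n) f = begin-equality
    Σ n f + f n                       ≈⟨ +-comm (Σ n f) (f n) ⟩
    f n + Σ n f                       ≈⟨ +-congˡ (Σ-reverse n f) ⟩
    f n + Σ n (λ i → f (n ∸ suc i))   ≈⟨ Σ-head n (λ i → f (n ∸ i)) ⟨
    Σ (suc n) (λ i → f (n ∸ i))       ∎

  Σ² : ℕ → (ℕ → ℕ → Carrier) → Carrier
  Σ² n t = Σ n (λ a → Σ n (t a))

  Σ²-suc : ∀ n t → Σ² (suc n) t ≈ Σ² n t + (Σ n (λ a → t a n + t n a) + t n n)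
  Σ²-suc n t = begin-equality
    Σ n (λ a → Σ n (t a) + t a n) + (Σ n (t n) + t n n)  ≈⟨ +-congʳ (Σ-distrib-+ n _ _) ⟩
    (Σ² n t + Σ n (λ a → t a n)) + (Σ n (t n) + t n n)   ≈⟨ +-assoc _ _ _ ⟩
    Σ² n t + (Σ n (λ a → t a n) + (Σ n (t n) + t n n))   ≈⟨ +-congˡ (+-assoc _ _ _) ⟨
    Σ² n t + ((Σ n (λ a → t a n) + Σ n (t n)) + t n n)   ≈⟨ +-congˡ (+-congʳ (Σ-distrib-+ n _ _)) ⟨
    Σ² n t + (Σ n (λ a → t a n + t n a) + t n n)         ∎

  Σ²-rearrangement : ∀ n (W h : ℕ → ℕ → Carrier) →
                     (∀ {a b} → a < b → W b a ≤R W a b) →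
                     (∀ {a b} → a < b → h b a ≤R h a b) →
                     Σ² n (λ a b → W a b * h b a) ≤R Σ² n (λ a b → W a b * h a b)
  Σ²-rearrangement zero    _ _ _  _  = ≤R.refl
  Σ²-rearrangement (suc n) W h W≤ h≤ = begin
    Σ² (suc n) (λ a b → W a b * h b a)
      ≈⟨ Σ²-suc n _ ⟩
    Σ² n (λ a b → W a b * h b a) + (Σ n (λ a → W a n * h n a + W n a * h a n) + W n n * h n n)
      ≤⟨ +-mono-≤ (Σ²-rearrangement n W h W≤ h≤)
                  (+-mono-≤R _ (Σ-mono-≤ n (λ a a<n → rearrangement (W≤ a<n) (h≤ a<n)))) ⟩
    Σ² n (λ a b → W a b * h a b) + (Σ n (λ a → W a n * h a n + W n a * h n a) + W n n * h n n)
      ≈⟨ Σ²-suc n _ ⟨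
    Σ² (suc n) (λ a b → W a b * h a b) ∎

  ⊛-comm : ∀ F G k → (F ⊛ G) k ≈ (G ⊛ F) k
  ⊛-comm F G k = begin-equality
    Σ (suc k) (λ i → F i * G (k ∸ i))              ≈⟨ Σ-reverse (suc k) _ ⟩
    Σ (suc k) (λ i → F (k ∸ i) * G (k ∸ (k ∸ i)))  ≈⟨ Σ-cong (suc k) swap ⟩
    Σ (suc k) (λ i → G i * F (k ∸ i))              ∎
    where
    swap : ∀ i → i < suc k → F (k ∸ i) * G (k ∸ (k ∸ i)) ≈ G i * F (k ∸ i)
    swap i (s≤s i≤k) = trans (*-comm _ _) (*-congʳ (reflexive (≡.cong G (ℕₚ.m∸[m∸n]≡n i≤k))))

  lincomb : ℕ → (ℕ → Carrier) → (ℕ → Seq R) → Seq R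
  lincomb n x F k = Σ n (λ a → x a * F a k)

  ⊛-linearˡ : ∀ n x F G k → (lincomb n x F ⊛ G) k ≈ Σ n (λ a → x a * (F a ⊛ G) k)
  ⊛-linearˡ n x F G k = begin-equality
    Σ (suc k) (λ t → Σ n (λ a → x a * F a t) * G (k ∸ t))
      ≈⟨ Σ-cong (suc k) (λ t _ → trans (*-distribʳ-Σ n _ _) (Σ-cong n (λ a _ → *-assoc _ _ _))) ⟩
    Σ (suc k) (λ t → Σ n (λ a → x a * (F a t * G (k ∸ t))))
      ≈⟨ Σ-comm (suc k) n _ ⟩
    Σ n (λ a → Σ (suc k) (λ t → x a * (F a t * G (k ∸ t))))
      ≈⟨ Σ-cong n (λ a _ → *-distribˡ-Σ (suc k) (x a) _) ⟨
    Σ n (λ a → x a * (F a ⊛ G) k) ∎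

  ⊛-linearʳ : ∀ n y F G k → (F ⊛ lincomb n y G) k ≈ Σ n (λ b → y b * (F ⊛ G b) k)
  ⊛-linearʳ n y F G k = begin-equality
    (F ⊛ lincomb n y G) k          ≈⟨ ⊛-comm F _ k ⟩
    (lincomb n y G ⊛ F) k          ≈⟨ ⊛-linearˡ n y G F k ⟩
    Σ n (λ b → y b * (G b ⊛ F) k)  ≈⟨ Σ-cong n (λ b _ → *-congˡ (⊛-comm (G b) F k)) ⟩
    Σ n (λ b → y b * (F ⊛ G b) k)  ∎

  ⊛-bilinear : ∀ n m x y F G k →
               (lincomb n x F ⊛ lincomb m y G) k ≈ Σ n (λ a → x a * Σ m (λ b → y b * (F a ⊛ G b) k))
  ⊛-bilinear n m x y F G k =
    trans (⊛-linearˡ n x F (lincomb m y G) k) (Σ-cong n (λ a _ → *-congˡ (⊛-linearʳ m y (F a) G k)))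

  module _ {f : ℕ → Seq R} (slc : StronglyQLogConvex R f) where

    private
      F : ℕ → ℕ → ℕ → Carrier
      F k a b = (f a ⊛ f b) k

    slc-chain : ∀ d {p q} → d ℕ.+ p ≤ q → ∀ k → (f (d ℕ.+ p) ⊛ f q) k ≤R (f p ⊛ f (d ℕ.+ q)) k
    slc-chain zero    _ k = ≤R.refl
    slc-chain (suc d) {p} {q} d+p<q k = begin
      F k (suc d ℕ.+ p) q    ≤⟨ 0≤-⇒≤ (slc (suc (d ℕ.+ p)) q (s≤s z≤n) d+p<q k) ⟩
      F k (d ℕ.+ p) (suc q)  ≤⟨ slc-chain d (ℕₚ.m≤n⇒m≤1+n (ℕₚ.<⇒≤ d+p<q)) k ⟩
      F k p (d ℕ.+ suc q)    ≡⟨ ≡.cong (F k p) (ℕₚ.+-suc d q) ⟩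
      F k p (suc d ℕ.+ q)    ∎

    slc-spread : ∀ a d u k → (f (a ℕ.+ d) ⊛ f (a ℕ.+ u)) k ≤R (f a ⊛ f (a ℕ.+ d ℕ.+ u)) k
    slc-spread a d u k with ℕₚ.≤-total d u
    ... | inj₁ d≤u = begin
      F k (a ℕ.+ d) (a ℕ.+ u)    ≡⟨ ≡.cong (λ r → F k r (a ℕ.+ u)) (ℕₚ.+-comm a d) ⟩
      F k (d ℕ.+ a) (a ℕ.+ u)    ≤⟨ slc-chain d (≡.subst (d ℕ.+ a ≤_) (ℕₚ.+-comm u a) (ℕₚ.+-monoˡ-≤ a d≤u)) k ⟩
      F k a (d ℕ.+ (a ℕ.+ u))    ≡⟨ ≡.cong (F k a) (ℕₚ.+-assoc d a u) ⟨
      F k a (d ℕ.+ a ℕ.+ u)      ≡⟨ ≡.cong (λ r → F k a (r ℕ.+ u)) (ℕₚ.+-comm d a) ⟩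
      F k a (a ℕ.+ d ℕ.+ u)      ∎
    ... | inj₂ u≤d = begin
      F k (a ℕ.+ d) (a ℕ.+ u)    ≈⟨ ⊛-comm (f (a ℕ.+ d)) (f (a ℕ.+ u)) k ⟩
      F k (a ℕ.+ u) (a ℕ.+ d)    ≡⟨ ≡.cong (λ r → F k r (a ℕ.+ d)) (ℕₚ.+-comm a u) ⟩
      F k (u ℕ.+ a) (a ℕ.+ d)    ≤⟨ slc-chain u (≡.subst (u ℕ.+ a ≤_) (ℕₚ.+-comm d a) (ℕₚ.+-monoˡ-≤ a u≤d)) k ⟩
      F k a (u ℕ.+ (a ℕ.+ d))    ≡⟨ ≡.cong (F k a) (ℕₚ.+-comm u (a ℕ.+ d)) ⟩
      F k a (a ℕ.+ d ℕ.+ u)      ∎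

  module _ (s : ℕ) where

    C : ℕ → ℕ → Carrier
    C n k = fromℕ (binomS s n k)

    Σ-C-truncate : ∀ n {N} (g : ℕ → Carrier) → s ℕ.* n < N →
                   Σ N (λ k → C n k * g k) ≈ Σ (suc (s ℕ.* n)) (λ k → C n k * g k)
    Σ-C-truncate n g sn<N = Σ-truncate sn<N (λ k sn<k → fromℕ-zeroˡ (g k) (s*n<k⇒binomS≡0 s n sn<k))

    C-suc : ∀ n {k K} → k < K → C (suc n) k ≈ Σ K (λ i → fromℕ (band s k i) * C n i)
    C-suc n {k} {K} k<K = begin-equality
      fromℕ (sumℕ (suc k) (λ i → binomS s n i ℕ.* onesUpTo s (k ∸ i)))
        ≈⟨ fromℕ-sumℕ (suc k) _ ⟩
      Σ (suc k) (λ i → fromℕ (binomS s n i ℕ.* onesUpTo s (k ∸ i)))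
        ≈⟨ Σ-cong (suc k) term ⟩
      Σ (suc k) (λ i → fromℕ (band s k i) * C n i)
        ≈⟨ Σ-truncate k<K (λ i k<i → fromℕ-zeroˡ (C n i) (band-> k<i)) ⟨
      Σ K (λ i → fromℕ (band s k i) * C n i)
        ∎
      where
      term : ∀ i → i < suc k →
             fromℕ (binomS s n i ℕ.* onesUpTo s (k ∸ i)) ≈ fromℕ (band s k i) * C n i
      term i (s≤s i≤k) = begin-equality
        fromℕ (binomS s n i ℕ.* onesUpTo s (k ∸ i))  ≈⟨ fromℕ-* (binomS s n i) _ ⟩
        C n i * fromℕ (onesUpTo s (k ∸ i))           ≈⟨ *-comm (C n i) _ ⟩
        fromℕ (onesUpTo s (k ∸ i)) * C n i           ≡⟨ ≡.cong (λ r → fromℕ r * C n i) (band-≤ i≤k) ⟨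
        fromℕ (band s k i) * C n i                   ∎

    Σ-band : ∀ {j N} (H : ℕ → Carrier) → j ℕ.+ s < N →
             Σ N (λ b → fromℕ (band s b j) * H b) ≈ Σ (suc s) (λ u → H (j ℕ.+ u))
    Σ-band {j} {N} H j+s<N = begin-equality
      Σ N g                                  ≈⟨ Σ-truncate (≡.subst (_≤ N) (≡.sym (ℕₚ.+-suc j s)) j+s<N) beyond ⟩
      Σ (j ℕ.+ suc s) g                      ≈⟨ Σ-split j (suc s) g ⟩
      Σ j g + Σ (suc s) (λ u → g (j ℕ.+ u))  ≈⟨ +-cong (Σ-zero j before) (Σ-cong (suc s) inside) ⟩
      0# + Σ (suc s) (λ u → H (j ℕ.+ u))     ≈⟨ +-identityˡ _ ⟩
      Σ (suc s) (λ u → H (j ℕ.+ u))          ∎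
      where
      g : ℕ → Carrier
      g b = fromℕ (band s b j) * H b
      beyond : ∀ b → j ℕ.+ suc s ≤ b → g b ≈ 0#
      beyond b j+s<b = fromℕ-zeroˡ (H b) (band-beyond {s} {b} {j} (≡.subst (_≤ b) (ℕₚ.+-suc j s) j+s<b))
      before : ∀ b → b < j → g b ≈ 0#
      before b b<j = fromℕ-zeroˡ (H b) (band-> b<j)
      inside : ∀ u → u < suc s → g (j ℕ.+ u) ≈ H (j ℕ.+ u)
      inside u (s≤s u≤s) = fromℕ-identityˡ (H (j ℕ.+ u)) (≡.trans (band-shift s j u) (onesUpTo-≤ u≤s))

    Σ-C-suc : ∀ n H → Σ (suc (s ℕ.* suc n)) (λ b → C (suc n) b * H b) ≈
                      Σ (suc (s ℕ.* n)) (λ j → C n j * Σ (suc s) (λ u → H (j ℕ.+ u)))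
    Σ-C-suc n H = begin-equality
      Σ N (λ b → C (suc n) b * H b)
        ≈⟨ Σ-cong N (λ b b<N → *-congʳ (C-suc n b<N)) ⟩
      Σ N (λ b → Σ N (λ j → fromℕ (band s b j) * C n j) * H b)
        ≈⟨ Σ-cong N (λ b _ → trans (*-distribʳ-Σ N (H b) _) (Σ-cong N (λ j _ → xy∙z≈y∙xz _ _ _))) ⟩
      Σ N (λ b → Σ N (λ j → C n j * (fromℕ (band s b j) * H b)))
        ≈⟨ Σ-comm N N _ ⟩
      Σ N (λ j → Σ N (λ b → C n j * (fromℕ (band s b j) * H b)))
        ≈⟨ Σ-cong N (λ j _ → *-distribˡ-Σ N (C n j) _) ⟨
      Σ N (λ j → C n j * Σ N (λ b → fromℕ (band s b j) * H b))
        ≈⟨ Σ-C-truncate n _ sn<N ⟩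
      Σ (suc (s ℕ.* n)) (λ j → C n j * Σ N (λ b → fromℕ (band s b j) * H b))
        ≈⟨ Σ-cong (suc (s ℕ.* n)) (λ j j<sn+1 → *-congˡ (Σ-band H (j+s<N (ℕₚ.≤-pred j<sn+1)))) ⟩
      Σ (suc (s ℕ.* n)) (λ j → C n j * Σ (suc s) (λ u → H (j ℕ.+ u)))
        ∎
      where
      N = suc (s ℕ.* suc n)
      sn<N : s ℕ.* n < N
      sn<N = s≤s (ℕₚ.*-monoʳ-≤ s (ℕₚ.n≤1+n n))
      j+s<N : ∀ {j} → j ≤ s ℕ.* n → j ℕ.+ s < N
      j+s<N {j} j≤sn = s≤s (≡.subst (j ℕ.+ s ≤_)
        (≡.trans (ℕₚ.+-comm (s ℕ.* n) s) (≡.sym (ℕₚ.*-suc s n))) (ℕₚ.+-monoˡ-≤ s j≤sn))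

    binomS-TP₂ : ∀ {n n′ a b} → n ≤ n′ → a ≤ b → C n b * C n′ a ≤R C n a * C n′ b
    binomS-TP₂ {b = zero} z≤n z≤n = ≤R.refl
    binomS-TP₂ {n′ = n′} {a} {suc b} z≤n _ = begin
      0# * C n′ a           ≈⟨ zeroˡ (C n′ a) ⟩
      0#                    ≤⟨ *-nonneg (fromℕ-nonneg (oneℕ a)) (fromℕ-nonneg (binomS s n′ (suc b))) ⟩
      C 0 a * C n′ (suc b)  ∎
    binomS-TP₂ {suc n} {suc n′} {a} {b} (s≤s n≤n′) a≤b = begin
      C (suc n) b * C (suc n′) a
        ≈⟨ *-cong (C-suc n ℕₚ.≤-refl) (C-suc n′ (s≤s a≤b)) ⟩
      Σ K (λ i → e b i * C n i) * Σ K (λ j → e a j * C n′ j)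
        ≈⟨ Σ-*-Σ K K _ _ ⟩
      Σ K (λ i → Σ K (λ j → (e b i * C n i) * (e a j * C n′ j)))
        ≈⟨ Σ-comm K K _ ⟩
      Σ K (λ j → Σ K (λ i → (e b i * C n i) * (e a j * C n′ j)))
        ≈⟨ Σ-cong K (λ j _ → Σ-cong K (λ i _ → trans (*-interchange _ _ _ _) (*-congʳ (*-comm _ _)))) ⟩
      Σ² K (λ i j → W i j * h j i)
        ≤⟨ Σ²-rearrangement K W h W≤ h≤ ⟩
      Σ² K (λ i j → W i j * h i j)
        ≈⟨ Σ-cong K (λ i _ → Σ-cong K (λ j _ → *-interchange _ _ _ _)) ⟩
      Σ K (λ i → Σ K (λ j → (e a i * C n i) * (e b j * C n′ j)))
        ≈⟨ Σ-*-Σ K K _ _ ⟨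
      Σ K (λ i → e a i * C n i) * Σ K (λ j → e b j * C n′ j)
        ≈⟨ *-cong (C-suc n (s≤s a≤b)) (C-suc n′ ℕₚ.≤-refl) ⟨
      C (suc n) a * C (suc n′) b
        ∎
      where
      K = suc b
      e : ℕ → ℕ → Carrier
      e k i = fromℕ (band s k i)
      W h : ℕ → ℕ → Carrier
      W i j = e a i * e b j
      h i j = C n i * C n′ j
      W≤ : ∀ {i j} → i < j → W j i ≤R W i j
      W≤ {i} {j} i<j = begin
        e a j * e b i                      ≈⟨ fromℕ-* (band s a j) (band s b i) ⟨
        fromℕ (band s a j ℕ.* band s b i)  ≤⟨ fromℕ-mono (band-TP₂ s a≤b (ℕₚ.<⇒≤ i<j)) ⟩
        fromℕ (band s a i ℕ.* band s b j)  ≈⟨ fromℕ-* (band s a i) (band s b j) ⟩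
        e a i * e b j                      ∎
      h≤ : ∀ {i j} → i < j → h j i ≤R h i j
      h≤ i<j = binomS-TP₂ n≤n′ (ℕₚ.<⇒≤ i<j)

  module _ (s : ℕ) {f : ℕ → Seq R} (slc : StronglyQLogConvex R f) where

    B : ℕ → Seq R
    B = binomTransform R s f

    Γ : ℕ → ℕ → ℕ → Carrier
    Γ k a j = Σ (suc s) (λ u → (f a ⊛ f (j ℕ.+ u)) k)

    B⊛B-suc : ∀ {n n′ N} → s ℕ.* n < N → s ℕ.* n′ < N → ∀ k →
              (B n ⊛ B (suc n′)) k ≈ Σ N (λ a → C s n a * Σ N (λ j → C s n′ j * Γ k a j))
    B⊛B-suc {n} {n′} {N} sn<N sn′<N k = begin-equality
      (B n ⊛ B (suc n′)) k
        ≈⟨ ⊛-bilinear (suc (s ℕ.* n)) (suc (s ℕ.* suc n′)) (C s n) (C s (suc n′)) f f k ⟩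
      Σ (suc (s ℕ.* n)) (λ a → C s n a * Σ (suc (s ℕ.* suc n′)) (λ b → C s (suc n′) b * (f a ⊛ f b) k))
        ≈⟨ Σ-cong (suc (s ℕ.* n)) (λ a _ → *-congˡ (Σ-C-suc s n′ (λ b → (f a ⊛ f b) k))) ⟩
      Σ (suc (s ℕ.* n)) (λ a → C s n a * Σ (suc (s ℕ.* n′)) (λ j → C s n′ j * Γ k a j))
        ≈⟨ Σ-C-truncate s n _ sn<N ⟨
      Σ N (λ a → C s n a * Σ (suc (s ℕ.* n′)) (λ j → C s n′ j * Γ k a j))
        ≈⟨ Σ-cong N (λ a _ → *-congˡ (Σ-C-truncate s n′ _ sn′<N)) ⟨
      Σ N (λ a → C s n a * Σ N (λ j → C s n′ j * Γ k a j))
        ∎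

    Γ-mono : ∀ k {a j} → a < j → Γ k j a ≤R Γ k a j
    Γ-mono k {a} a<j with ℕₚ.m≤n⇒∃[o]m+o≡n (ℕₚ.<⇒≤ a<j)
    ... | d , ≡.refl = Σ-mono-≤ (suc s) (λ u _ → slc-spread slc a d u k)

    binomTransform-step : ∀ {p m} → p < m → ∀ k → (B (suc p) ⊛ B m) k ≤R (B p ⊛ B (suc m)) k
    binomTransform-step {p} {m} p<m k = begin
      (B (suc p) ⊛ B m) k
        ≈⟨ ⊛-comm (B (suc p)) (B m) k ⟩
      (B m ⊛ B (suc p)) k
        ≈⟨ B⊛B-suc ℕₚ.≤-refl sp<N k ⟩
      Σ N (λ a → Y a * Σ N (λ j → X j * Γ k a j))
        ≈⟨ Σ-factor N N Y X (Γ k) ⟩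
      Σ N (λ a → Σ N (λ j → (Y a * X j) * Γ k a j))
        ≈⟨ Σ-comm N N _ ⟩
      Σ N (λ j → Σ N (λ a → (Y a * X j) * Γ k a j))
        ≈⟨ Σ-cong N (λ _ _ → Σ-cong N (λ _ _ → *-congʳ (*-comm _ _))) ⟩
      Σ² N (λ a b → (X a * Y b) * Γ k b a)
        ≤⟨ Σ²-rearrangement N (λ a b → X a * Y b) (Γ k) TP (Γ-mono k) ⟩
      Σ² N (λ a b → (X a * Y b) * Γ k a b)
        ≈⟨ Σ-factor N N X Y (Γ k) ⟨
      Σ N (λ a → X a * Σ N (λ j → Y j * Γ k a j))
        ≈⟨ B⊛B-suc sp<N ℕₚ.≤-refl k ⟨
      (B p ⊛ B (suc m)) k
        ∎
      where
      N = suc (s ℕ.* m)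
      X Y : ℕ → Carrier
      X = C s p
      Y = C s m
      sp<N : s ℕ.* p < N
      sp<N = s≤s (ℕₚ.*-monoʳ-≤ s (ℕₚ.<⇒≤ p<m))
      TP : ∀ {a b} → a < b → X b * Y a ≤R X a * Y b
      TP a<b = binomS-TP₂ s (ℕₚ.<⇒≤ p<m) (ℕₚ.<⇒≤ a<b)

mainTheorem5 : ∀ {c ℓ₁ ℓ₂ : Level} (R : OrderedCommRing c ℓ₁ ℓ₂)
               (s : ℕ) → 1 ≤ s →
               (f : ℕ → Seq R) →
               (∀ k → IsPolynomial R (f k)) →
               StronglyQLogConvex R f →
               StronglyQLogConvex R (binomTransform R s f)
mainTheorem5 R s _ f _ slc zero    m ()  _   _
mainTheorem5 R s _ f _ slc (suc p) m _   p<m k = ≤⇒0≤- R (binomTransform-step R s slc p<m k)
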